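{- Let $G$ be a strongly connected digraph and let $(x,y)$ be an edge of $G$. Define test (A): "$G\setminus(x,y)$ contains two edge-disjoint directed paths from $x$ to $y$", and test (B): "$(x,y)$ is not a strong bridge of $G$ and $G\setminus(x,y)$ has the same $2$-edge-connected blocks as $G$". Then (A) implies (B), i.e. the two edge-disjoint paths test deletes $(x,y)$ only if the $2$-edge-connected blocks test deletes it as well. Moreover, if $x$ and $y$ belong to the same $2$-edge-connected block of $G$, then (A) holds if and only if (B) holds.
   Context: An edge is a strong bridge of a digraph if its removal increases the number of strongly connected components. Two distinct vertices $v,w$ are $2$-edge-connected if there are two edge-disjoint directed paths from $v$ to $w$ and two edge-disjoint directed paths from $w$ to $v$. A $2$-edge-connected block of a digraph is a maximal vertex subset $B$ such that every two distinct vertices of $B$ are $2$-edge-connected. $G\setminus(x,y)$ denotes $G$ with the edge $(x,y)$ removed. (In the paper, test (A) is the deletion rule of algorithm Test2EDP-B and test (B) the deletion rule of algorithm Test2ECB-B, each applied to the current subgraph.) -}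

module Defs where

open import Data.Nat using (ℕ; suc; _<_)
open import Data.Fin using (Fin)
open import Data.Fin.Subset using (Subset; _∈_; _⊆_)
open import Data.Vec using (Vec; lookup; removeAt)
open import Data.List using (List; []; _∷_)
open import Data.List.Relation.Unary.Unique.Propositional using (Unique)
import Data.List.Membership.Propositional as LM
open import Data.Product using (Σ; _×_; _,_; ∃; ∃₂)
open import Function.Bundles using (_⇔_)
open import Function.Definitions using (Surjective)
open import Relation.Binary.PropositionalEquality using (_≡_; _≢_)
open import Relation.Nullary using (¬_)

-- A (finite, multi-)digraph with vertex set Fin n and m edges; edge i : Fin m
-- goes from proj₁ (lookup G i) to proj₂ (lookup G i).
Digraph : ℕ → ℕ → Set
Digraph n m = Vec (Fin n × Fin n) m

-- G \ e : delete edge e (edges are re-indexed, the remaining order kept)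
_∖_ : ∀ {n m} → Digraph n (suc m) → Fin (suc m) → Digraph n m
G ∖ e = removeAt G e

data Walk {n m} (G : Digraph n m) : Fin n → Fin n → Set where
  [] : ∀ {u} → Walk G u u
  step : ∀ {u v w} (e : Fin m) → lookup G e ≡ (u , v) → Walk G v w → Walk G u w

module _ {n m} {G : Digraph n m} where
  walkEdges : ∀ {u v} → Walk G u v → List (Fin m)
  walkEdges [] = []
  walkEdges (step e _ p) = e ∷ walkEdges p

  walkVerts : ∀ {u v} → Walk G u v → List (Fin n)
  walkVerts {u} [] = u ∷ []
  walkVerts {u} (step e _ p) = u ∷ walkVerts p

record Path {n m} (G : Digraph n m) (u v : Fin n) : Set where
  constructor path
  field
    walk   : Walk G u v
    simple : Unique (walkVerts walk)
open Path public

EdgeDisjoint : ∀ {n m} {G : Digraph n m} {u v u' v'} → Path G u v → Path G u' v' → Set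
EdgeDisjoint p q = ∀ e → e LM.∈ walkEdges (walk p) → ¬ (e LM.∈ walkEdges (walk q))

TwoEDP : ∀ {n m} → Digraph n m → Fin n → Fin n → Set
TwoEDP G u v = Σ (Path G u v) λ p → Σ (Path G u v) λ q → EdgeDisjoint p q

Reachable : ∀ {n m} → Digraph n m → Fin n → Fin n → Set
Reachable G u v = Walk G u v

StronglyConnected : ∀ {n m} → Digraph n m → Set
StronglyConnected G = ∀ u v → Reachable G u v

MutuallyReachable : ∀ {n m} → Digraph n m → Fin n → Fin n → Set
MutuallyReachable G u v = Reachable G u v × Reachable G v u

HasSCCCount : ∀ {n m} → Digraph n m → ℕ → Set
HasSCCCount {n} G k = Σ (Fin n → Fin k) λ f →
  Surjective _≡_ _≡_ f × (∀ u v → (f u ≡ f v) ⇔ MutuallyReachable G u v)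

StrongBridge : ∀ {n m} → Digraph n (suc m) → Fin (suc m) → Set
StrongBridge G e = ∃₂ λ k k' → HasSCCCount G k × HasSCCCount (G ∖ e) k' × k < k'

TwoEdgeConnected : ∀ {n m} → Digraph n m → Fin n → Fin n → Set
TwoEdgeConnected G v w = v ≢ w × TwoEDP G v w × TwoEDP G w v

Pairwise2EC : ∀ {n m} → Digraph n m → Subset n → Set
Pairwise2EC G B = ∀ v w → v ∈ B → w ∈ B → v ≢ w → TwoEdgeConnected G v w

Is2ECBlock : ∀ {n m} → Digraph n m → Subset n → Set
Is2ECBlock G B = Pairwise2EC G B × (∀ B' → B ⊆ B' → Pairwise2EC G B' → B' ≡ B)

Same2ECBlocks : ∀ {n m m'} → Digraph n m → Digraph n m' → Set
Same2ECBlocks {n} G H = ∀ (B : Subset n) → Is2ECBlock G B ⇔ Is2ECBlock H B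

TestA : ∀ {n m} → Digraph n (suc m) → Fin (suc m) → Fin n → Fin n → Set
TestA G e x y = TwoEDP (G ∖ e) x y

TestB : ∀ {n m} → Digraph n (suc m) → Fin (suc m) → Set
TestB G e = ¬ StrongBridge G e × Same2ECBlocks G (G ∖ e)

SameBlock : ∀ {n m} → Digraph n m → Fin n → Fin n → Set
SameBlock {n} G x y = Σ (Subset n) λ B → Is2ECBlock G B × x ∈ B × y ∈ B

-- If G ∖ (x,y) has two edge-disjoint x–y paths, then for every edge f ≠ (x,y)
-- one of them misses f, so any walk of G can be turned into a walk of
-- G ∖ (x,y) that avoids f by replacing each use of (x,y) with that path.
-- Hence mutual reachability is the same in G and G ∖ (x,y), so (x,y) is not a
-- strong bridge, and no single edge separates two vertices in G ∖ (x,y) that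
-- it does not separate in G; by Menger's theorem for two paths the relation
-- "two edge-disjoint a–b paths", and with it the 2-edge-connected blocks, are
-- the same in both graphs. Conversely, if x and y share a block of G and the
-- blocks of G ∖ (x,y) are those of G, then x and y are 2-edge-connected in
-- G ∖ (x,y).
--
-- Menger's theorem for two paths is proved by one augmentation step. Given an
-- a–b path P, either the residual graph of P has an a–b path, and the 0/1 flow
-- of value 2 obtained by augmenting splits into two edge-disjoint a–b walks,
-- or the set S of vertices residually reachable from a is left by a single
-- edge of G, the unique edge by which P leaves S, and every a–b walk uses it.
module Submission where

open import Defs
open import Algebra.Bundles using (AbelianGroup)
open import Data.Bool using (Bool; true; false; if_then_else_)
open import Data.Bool.Properties using (¬-not)
open import Data.Empty using (⊥-elim)
open import Data.Fin using (Fin; _≟_; punchIn; punchOut)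
import Data.Fin.Properties as Finₚ
open import Data.Integer using (ℤ; 0ℤ; 1ℤ; -1ℤ; _+_; _-_; _≤_; +≤+; -≤+)
import Data.Integer.Properties as ℤₚ
open import Data.Integer.Tactic.RingSolver using (solve-∀)
open import Data.List as List using (List; []; _∷_; _++_; length; map)
open import Data.List.Membership.Propositional using (_∈_; _∉_)
open import Data.List.Membership.Propositional.Properties using (∈-++⁻; ∈-map⁻; ∈-lookup)
open import Data.List.Relation.Binary.Subset.Propositional using (_⊆_)
open import Data.List.Relation.Unary.All as All using ([])
open import Data.List.Relation.Unary.All.Properties using (¬Any⇒All¬)
open import Data.List.Relation.Unary.AllPairs using ([]; _∷_)
open import Data.List.Relation.Unary.Any using (here; there; any?)
open import Data.List.Relation.Unary.Unique.Propositional using (Unique)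
open import Data.Nat as ℕ using (ℕ; zero; suc; z≤n; s≤s; s≤s⁻¹)
import Data.Nat.Properties as ℕₚ
open import Data.Product using (Σ; ∃; _×_; _,_; proj₁; proj₂; swap)
open import Data.Sum using (_⊎_; inj₁; inj₂; [_,_]′; map₂)
open import Data.Vec using (Vec; []; _∷_; lookup; _[_]≔_; replicate; tabulate)
import Data.Vec.Properties as Vecₚ
open import Function.Bundles using (Equivalence; mk⇔)
open import Relation.Nullary using (¬_; Dec; yes; no; contradiction)
open import Relation.Nullary.Decidable using (_×-dec_; map′)
open import Relation.Binary.PropositionalEquality
open import Algebra.Properties.CommutativeSemigroup ℤₚ.+-commutativeSemigroup using (x∙yz≈y∙xz)
open import Algebra.Properties.Group (AbelianGroup.group ℤₚ.+-0-abelianGroup) using (∙-cancelʳ)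

Unique⇒length≤ : ∀ {n} {xs : List (Fin n)} → Unique xs → length xs ℕ.≤ n
Unique⇒length≤ {xs = xs} xs! = Finₚ.injective⇒≤ (lookup-injective xs xs!)
  where
  lookup-injective : ∀ xs → Unique xs → ∀ {i j} → List.lookup xs i ≡ List.lookup xs j → i ≡ j
  lookup-injective (x ∷ xs) _ {Fin.zero} {Fin.zero} _ = refl
  lookup-injective (x ∷ xs) (x∉xs ∷ _) {Fin.zero} {Fin.suc j} x≡ = ⊥-elim (All.lookup x∉xs (∈-lookup j) x≡)
  lookup-injective (x ∷ xs) (x∉xs ∷ _) {Fin.suc i} {Fin.zero} ≡x = ⊥-elim (All.lookup x∉xs (∈-lookup i) (sym ≡x))
  lookup-injective (x ∷ xs) (_ ∷ xs!) {Fin.suc i} {Fin.suc j} eq = cong Fin.suc (lookup-injective xs xs! eq)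

module _ {n m} {G : Digraph n m} where

  infixr 5 _++ʷ_
  _++ʷ_ : ∀ {a b c} → Walk G a b → Walk G b c → Walk G a c
  [] ++ʷ q = q
  step g eq p ++ʷ q = step g eq (p ++ʷ q)

  walkEdges-++ʷ : ∀ {a b c} (p : Walk G a b) (q : Walk G b c) →
    walkEdges (p ++ʷ q) ≡ walkEdges p ++ walkEdges q
  walkEdges-++ʷ [] q = refl
  walkEdges-++ʷ (step g eq p) q = cong (g ∷_) (walkEdges-++ʷ p q)

  length-walkVerts : ∀ {a b} (p : Walk G a b) → length (walkVerts p) ≡ suc (length (walkEdges p))
  length-walkVerts [] = refl
  length-walkVerts (step g eq p) = cong suc (length-walkVerts p)

  source∈walkVerts : ∀ {a b g} (p : Walk G a b) → g ∈ walkEdges p → proj₁ (lookup G g) ∈ walkVerts p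
  source∈walkVerts (step g eq p) (here refl) = here (cong proj₁ eq)
  source∈walkVerts (step g eq p) (there g∈p) = there (source∈walkVerts p g∈p)

  walkEdges-unique : ∀ {a b} (p : Walk G a b) → Unique (walkVerts p) → Unique (walkEdges p)
  walkEdges-unique [] _ = []
  walkEdges-unique (step g eq p) (a∉p ∷ p!) = ¬Any⇒All¬ (walkEdges p) g∉p ∷ walkEdges-unique p p!
    where
    g∉p : g ∉ walkEdges p
    g∉p g∈p = All.lookup a∉p (subst (_∈ walkVerts p) (cong proj₁ eq) (source∈walkVerts p g∈p)) refl

  PathUsing : Fin n → Fin n → List (Fin m) → Set
  PathUsing a b es = Σ (Path G a b) λ q → walkEdges (walk q) ⊆ es

  suffixPath : ∀ {a b c} (p : Walk G a b) → Unique (walkVerts p) → c ∈ walkVerts p →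
    PathUsing c b (walkEdges p)
  suffixPath [] p! (here refl) = path [] p! , λ ()
  suffixPath (step g eq p) p! (here refl) = path (step g eq p) p! , λ i → i
  suffixPath (step g eq p) (_ ∷ p!) (there c∈p) with suffixPath p p! c∈p
  ... | q , q⊆p = q , λ i → there (q⊆p i)

  toPath : ∀ {a b} (p : Walk G a b) → PathUsing a b (walkEdges p)
  toPath [] = path [] ([] ∷ []) , λ ()
  toPath {a} (step g eq p) with toPath p
  ... | q , q⊆p with any? (a ≟_) (walkVerts (walk q))
  ...   | yes a∈q = let (r , r⊆q) = suffixPath (walk q) (simple q) a∈q in r , λ i → there (q⊆p (r⊆q i))
  ...   | no a∉q = path (step g eq (walk q)) (¬Any⇒All¬ _ a∉q ∷ simple q) ,
                   λ { (here refl) → here refl ; (there i) → there (q⊆p i) }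

TwoEDP-refl : ∀ {n m} {G : Digraph n m} a → TwoEDP G a a
TwoEDP-refl a = path [] ([] ∷ []) , path [] ([] ∷ []) , λ _ ()

avoidingWalk : ∀ {n m} {G : Digraph n m} {a b} → TwoEDP G a b → ∀ f →
  Σ (Walk G a b) λ w → f ∉ walkEdges w
avoidingWalk (p , q , disjoint) f with any? (f ≟_) (walkEdges (walk p))
... | yes f∈p = walk q , disjoint f f∈p
... | no f∉p = walk p , f∉p

module _ {n m} (G : Digraph n m) where

  ReachableWithin : ℕ → Fin n → Fin n → Set
  ReachableWithin k a b = Σ (Walk G a b) λ p → length (walkEdges p) ℕ.≤ k

  reachableWithin? : ∀ k a b → Dec (ReachableWithin k a b)
  reachableWithin? k a b with a ≟ b
  ... | yes refl = yes ([] , z≤n)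
  reachableWithin? zero a b | no a≢b = no λ { ([] , _) → a≢b refl ; (step _ _ _ , ()) }
  reachableWithin? (suc k) a b | no a≢b
    with Finₚ.any? (λ g → (proj₁ (lookup G g) ≟ a) ×-dec reachableWithin? k (proj₂ (lookup G g)) b)
  ... | yes (g , refl , p , |p|≤k) = yes (step g refl p , s≤s |p|≤k)
  ... | no ¬out = no λ
    { ([] , _) → a≢b refl
    ; (step g eq p , s≤s |p|≤k) →
        ¬out (g , cong proj₁ eq , subst (λ v → ReachableWithin k v b) (sym (cong proj₂ eq)) (p , |p|≤k)) }

  reachable⇒reachableWithin : ∀ {a b} → Reachable G a b → ReachableWithin n a b
  reachable⇒reachableWithin p = walk q , ℕₚ.<⇒≤ |q|<n
    where
    q : Path G _ _
    q = proj₁ (toPath p)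
    |q|<n : length (walkEdges (walk q)) ℕ.< n
    |q|<n = subst (ℕ._≤ n) (length-walkVerts (walk q)) (Unique⇒length≤ (simple q))

  reachable? : ∀ a b → Dec (Reachable G a b)
  reachable? a b = map′ proj₁ reachable⇒reachableWithin (reachableWithin? n a b)

-- Edges leaving a vertex set

module Exits {n m} (G : Digraph n m) (S : Fin n → Set) (S? : ∀ v → Dec (S v)) where

  Leaves : Fin m → Set
  Leaves g = S (proj₁ (lookup G g)) × ¬ S (proj₂ (lookup G g))

  leavingEdge : ∀ {a b} (p : Walk G a b) → S a → ¬ S b → ∃ λ g → g ∈ walkEdges p × Leaves g
  leavingEdge [] a∈S b∉S = ⊥-elim (b∉S a∈S)
  leavingEdge (step {v = c} g refl p) a∈S b∉S with S? c
  ... | yes c∈S = let (h , h∈p , h-leaves) = leavingEdge p c∈S b∉S in h , there h∈p , h-leaves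
  ... | no c∉S = g , here refl , a∈S , c∉S

  NeverEnters : ∀ {a b} → Walk G a b → Set
  NeverEnters p = ∀ g → g ∈ walkEdges p → S (proj₂ (lookup G g)) → S (proj₁ (lookup G g))

  staysOutside : ∀ {a b} (p : Walk G a b) → ¬ S a → NeverEnters p →
    ∀ g → g ∈ walkEdges p → ¬ S (proj₁ (lookup G g))
  staysOutside (step h refl p) a∉S _ g (here refl) = a∉S
  staysOutside (step h refl p) a∉S never g (there g∈p) =
    staysOutside p (λ c∈S → a∉S (never h (here refl) c∈S)) (λ g′ i → never g′ (there i)) g g∈p

  leavingEdge-unique : ∀ {a b} (p : Walk G a b) → NeverEnters p → ∀ {g₁ g₂} →
    g₁ ∈ walkEdges p → g₂ ∈ walkEdges p → Leaves g₁ → Leaves g₂ → g₁ ≡ g₂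
  leavingEdge-unique (step {v = c} h refl p) never i₁ i₂ l₁ l₂ with S? c
  ... | yes c∈S = leavingEdge-unique p (λ g i → never g (there i)) (later i₁ l₁) (later i₂ l₂) l₁ l₂
    where
    later : ∀ {g} → g ∈ walkEdges (step h refl p) → Leaves g → g ∈ walkEdges p
    later (here refl) (_ , c∉S) = ⊥-elim (c∉S c∈S)
    later (there i) _ = i
  ... | no c∉S = trans (first i₁ l₁) (sym (first i₂ l₂))
    where
    first : ∀ {g} → g ∈ walkEdges (step h refl p) → Leaves g → g ≡ h
    first (here g≡h) _ = g≡h
    first (there i) (src∈S , _) = ⊥-elim (staysOutside p c∉S (λ g i′ → never g (there i′)) _ i src∈S)

-- 0/1 flows and their excess

Flow : ℕ → Set
Flow m = Vec Bool m

∅ : ∀ {m} → Flow m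
∅ = replicate _ false

size : ∀ {m} → Flow m → ℕ
size [] = 0
size (true ∷ F) = suc (size F)
size (false ∷ F) = size F

δ : ∀ {n} → Fin n → Fin n → ℤ
δ a w with a ≟ w
... | yes _ = 1ℤ
... | no _ = 0ℤ

∂ : ∀ {n} → Fin n × Fin n → Fin n → ℤ
∂ (p , q) w = δ p w - δ q w

excess : ∀ {n m} → Digraph n m → Flow m → Fin n → ℤ
excess [] [] w = 0ℤ
excess (pq ∷ G) (true ∷ F) w = ∂ pq w + excess G F w
excess (pq ∷ G) (false ∷ F) w = excess G F w

module _ {n : ℕ} where

  δ-refl : (a : Fin n) → δ a a ≡ 1ℤ
  δ-refl a with a ≟ a
  ... | yes _ = refl
  ... | no a≢a = contradiction refl a≢a

  δ-≢ : {a b : Fin n} → a ≢ b → δ a b ≡ 0ℤ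
  δ-≢ {a} {b} a≢b with a ≟ b
  ... | yes a≡b = contradiction a≡b a≢b
  ... | no _ = refl

  0≤δ : (a b : Fin n) → 0ℤ ≤ δ a b
  0≤δ a b with a ≟ b
  ... | yes _ = +≤+ z≤n
  ... | no _ = +≤+ z≤n

  ∂-concat : (a c b w : Fin n) → ∂ (a , c) w + ∂ (c , b) w ≡ ∂ (a , b) w
  ∂-concat a c b w = telescope (δ a w) (δ c w) (δ b w)
    where
    telescope : ∀ x y z → (x - y) + (y - z) ≡ x - z
    telescope = solve-∀

  ∂-swap : ∀ {x y} (a b w : Fin n) → x ≡ ∂ (a , b) w + y → y ≡ x + ∂ (b , a) w
  ∂-swap a b w refl = cancel (δ a w) (δ b w) _
    where
    cancel : ∀ i j y → y ≡ ((i - j) + y) + (j - i)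
    cancel = solve-∀

  ∂-source : {a b : Fin n} → a ≢ b → ∂ (a , b) a ≡ 1ℤ
  ∂-source {a} a≢b rewrite δ-refl a | δ-≢ (λ b≡a → a≢b (sym b≡a)) = refl

  0≤∂ : (a : Fin n) {b z : Fin n} → z ≢ b → 0ℤ ≤ ∂ (a , b) z
  0≤∂ a {z = z} z≢b rewrite δ-≢ (λ b≡z → z≢b (sym b≡z)) | ℤₚ.+-identityʳ (δ a z) = 0≤δ a z

  -1≤∂ : (a b z : Fin n) → -1ℤ ≤ ∂ (a , b) z
  -1≤∂ a b z with b ≟ z
  ... | yes refl = ℤₚ.+-monoˡ-≤ -1ℤ (0≤δ a b)
  ... | no _ = ℤₚ.≤-trans -≤+ (ℤₚ.+-monoˡ-≤ 0ℤ (0≤δ a z))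

  +-∂-diag : (x : ℤ) (a w : Fin n) → x + ∂ (a , a) w ≡ x
  +-∂-diag x a w = trans (cong (x +_) (ℤₚ.+-inverseʳ (δ a w))) (ℤₚ.+-identityʳ x)

module _ {m : ℕ} where

  lookup-set : (F : Flow m) (g : Fin m) (b : Bool) → lookup (F [ g ]≔ b) g ≡ b
  lookup-set F g b = Vecₚ.lookup∘updateAt g F

  lookup-set-≢ : (F : Flow m) {g h : Fin m} (b : Bool) → g ≢ h → lookup (F [ g ]≔ b) h ≡ lookup F h
  lookup-set-≢ F b g≢h = Vecₚ.lookup∘updateAt′ _ _ (λ h≡g → g≢h (sym h≡g)) F

  cleared-⊆ : (F : Flow m) (g h : Fin m) → lookup (F [ g ]≔ false) h ≡ true → lookup F h ≡ true
  cleared-⊆ F g h Fh with g ≟ h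
  ... | yes refl = contradiction (trans (sym (lookup-set F g false)) Fh) λ ()
  ... | no g≢h = trans (sym (lookup-set-≢ F false g≢h)) Fh

size-clear : ∀ {m} (F : Flow m) g → lookup F g ≡ true → size F ≡ suc (size (F [ g ]≔ false))
size-clear (true ∷ F) Fin.zero _ = refl
size-clear (false ∷ F) Fin.zero ()
size-clear (true ∷ F) (Fin.suc g) Fg = cong suc (size-clear F g Fg)
size-clear (false ∷ F) (Fin.suc g) Fg = size-clear F g Fg

excess-∅ : ∀ {n m} (G : Digraph n m) w → excess G ∅ w ≡ 0ℤ
excess-∅ [] w = refl
excess-∅ (_ ∷ G) w = excess-∅ G w

excess-set : ∀ {n m} (G : Digraph n m) (F : Flow m) g w → lookup F g ≡ false →
  excess G (F [ g ]≔ true) w ≡ ∂ (lookup G g) w + excess G F w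
excess-set (pq ∷ G) (false ∷ F) Fin.zero w _ = refl
excess-set (pq ∷ G) (true ∷ F) Fin.zero w ()
excess-set (pq ∷ G) (true ∷ F) (Fin.suc g) w Fg =
  trans (cong (∂ pq w +_) (excess-set G F g w Fg)) (x∙yz≈y∙xz (∂ pq w) (∂ (lookup G g) w) (excess G F w))
excess-set (pq ∷ G) (false ∷ F) (Fin.suc g) w Fg = excess-set G F g w Fg

excess-clear : ∀ {n m} (G : Digraph n m) (F : Flow m) g w → lookup F g ≡ true →
  excess G F w ≡ ∂ (lookup G g) w + excess G (F [ g ]≔ false) w
excess-clear G F g w Fg = begin
  excess G F w                                    ≡⟨ cong (λ F′ → excess G F′ w) (sym refill) ⟩
  excess G ((F [ g ]≔ false) [ g ]≔ true) w       ≡⟨ excess-set G (F [ g ]≔ false) g w (lookup-set F g false) ⟩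
  ∂ (lookup G g) w + excess G (F [ g ]≔ false) w  ∎
  where
  open ≡-Reasoning
  refill : (F [ g ]≔ false) [ g ]≔ true ≡ F
  refill = trans (Vecₚ.[]≔-idempotent F g) (trans (cong (F [ g ]≔_) (sym Fg)) (Vecₚ.[]≔-lookup F g))

excess-positive⇒outEdge : ∀ {n m} (G : Digraph n m) (F : Flow m) s → 1ℤ ≤ excess G F s →
  ∃ λ g → lookup F g ≡ true × proj₁ (lookup G g) ≡ s
excess-positive⇒outEdge [] [] s (+≤+ ())
excess-positive⇒outEdge (pq ∷ G) (false ∷ F) s pos =
  let (g , Fg , src) = excess-positive⇒outEdge G F s pos in Fin.suc g , Fg , src
excess-positive⇒outEdge ((p , q) ∷ G) (true ∷ F) s pos with p ≟ s
... | yes p≡s = Fin.zero , refl , p≡s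
... | no p≢s = let (g , Fg , src) = excess-positive⇒outEdge G F s pos′ in Fin.suc g , Fg , src
  where
  -- In this branch δ p s reduces to 0ℤ, so ∂ (p , q) s is 0ℤ - δ q s.
  pos′ : 1ℤ ≤ excess G F s
  pos′ = ℤₚ.≤-trans pos (ℤₚ.≤-trans (ℤₚ.+-monoˡ-≤ (excess G F s) (ℤₚ.i≤j⇒i-j≤0 (0≤δ q s)))
                                     (ℤₚ.≤-reflexive (ℤₚ.+-identityˡ _)))

-- Augmenting walks and the decomposition of flows

module _ {n m} (G : Digraph n m) where

  open ≡-Reasoning

  private
    shuffle : (x y z : ℤ) → (x + y) + z ≡ y + (x + z)
    shuffle x y z = trans (ℤₚ.+-assoc x y z) (x∙yz≈y∙xz x y z)

  data Augmenting : Flow m → Fin n → Fin n → Set where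
    [] : ∀ {F a} → Augmenting F a a
    forward : ∀ {F a c b} g → lookup F g ≡ false → lookup G g ≡ (a , c) →
      Augmenting (F [ g ]≔ true) c b → Augmenting F a b
    backward : ∀ {F a c b} g → lookup F g ≡ true → lookup G g ≡ (c , a) →
      Augmenting (F [ g ]≔ false) c b → Augmenting F a b

  augment : ∀ {F a b} → Augmenting F a b → Flow m
  augment {F} [] = F
  augment (forward _ _ _ r) = augment r
  augment (backward _ _ _ r) = augment r

  excess-augment : ∀ {F a b} (r : Augmenting F a b) w →
    excess G (augment r) w ≡ excess G F w + ∂ (a , b) w
  excess-augment {F} {a} [] w = sym (+-∂-diag (excess G F w) a w)
  excess-augment {F} {a} {b} (forward {c = c} g Fg refl r) w = begin
    excess G (augment r) w                      ≡⟨ excess-augment r w ⟩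
    excess G (F [ g ]≔ true) w + ∂ (c , b) w    ≡⟨ cong (_+ ∂ (c , b) w) (excess-set G F g w Fg) ⟩
    (∂ (a , c) w + excess G F w) + ∂ (c , b) w  ≡⟨ shuffle (∂ (a , c) w) (excess G F w) (∂ (c , b) w) ⟩
    excess G F w + (∂ (a , c) w + ∂ (c , b) w)  ≡⟨ cong (excess G F w +_) (∂-concat a c b w) ⟩
    excess G F w + ∂ (a , b) w                  ∎
  excess-augment {F} {a} {b} (backward {c = c} g Fg refl r) w = begin
    excess G (augment r) w                       ≡⟨ excess-augment r w ⟩
    excess G F′ w + ∂ (c , b) w                  ≡⟨ cong (excess G F′ w +_) (∂-concat c a b w) ⟨
    excess G F′ w + (∂ (c , a) w + ∂ (a , b) w)  ≡⟨ shuffle (∂ (c , a) w) (excess G F′ w) (∂ (a , b) w) ⟨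
    (∂ (c , a) w + excess G F′ w) + ∂ (a , b) w  ≡⟨ cong (_+ ∂ (a , b) w) (excess-clear G F g w Fg) ⟨
    excess G F w + ∂ (a , b) w                   ∎
    where
    F′ : Flow m
    F′ = F [ g ]≔ false

  DrainsTo : Flow m → Fin n → Fin n → Set
  DrainsTo F s t = (s ≢ t → 1ℤ ≤ excess G F s) × (∀ z → z ≢ t → 0ℤ ≤ excess G F z)

  drainsTo-if-∂≤excess : ∀ {F a b} → a ≢ b → (∀ z → z ≢ b → ∂ (a , b) z ≤ excess G F z) →
    DrainsTo F a b
  drainsTo-if-∂≤excess {a = a} a≢b ∂≤ =
    (λ _ → subst (_≤ _) (∂-source a≢b) (∂≤ a a≢b)) ,
    (λ z z≢b → ℤₚ.≤-trans (0≤∂ a z≢b) (∂≤ z z≢b))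

  drainsTo-clear : ∀ {F s w t} g → lookup F g ≡ true → lookup G g ≡ (s , w) → s ≢ t →
    DrainsTo F s t → DrainsTo (F [ g ]≔ false) w t
  drainsTo-clear {F} {s} {w} {t} g Fg g=sw s≢t (at-s , elsewhere) = at-w , elsewhere′
    where
    cleared : ∀ z → excess G (F [ g ]≔ false) z ≡ excess G F z + ∂ (w , s) z
    cleared z = ∂-swap s w z (trans (excess-clear G F g z Fg) (cong (λ e → ∂ e z + _) g=sw))
    at-w : w ≢ t → 1ℤ ≤ excess G (F [ g ]≔ false) w
    at-w w≢t rewrite cleared w with w ≟ s
    ... | yes refl rewrite +-∂-diag (excess G F w) w w = at-s s≢t
    ... | no w≢s rewrite ∂-source w≢s = ℤₚ.+-monoˡ-≤ 1ℤ (elsewhere w w≢t)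
    elsewhere′ : ∀ z → z ≢ t → 0ℤ ≤ excess G (F [ g ]≔ false) z
    elsewhere′ z z≢t rewrite cleared z with z ≟ s
    ... | yes refl = ℤₚ.+-mono-≤ (at-s s≢t) (-1≤∂ w z z)
    ... | no z≢s = ℤₚ.+-mono-≤ (elsewhere z z≢t) (0≤∂ w z≢s)

  record Extraction (F : Flow m) (s t : Fin n) : Set where
    field
      route : Walk G s t
      rest : Flow m
      route⊆F : ∀ g → g ∈ walkEdges route → lookup F g ≡ true
      route∉rest : ∀ g → g ∈ walkEdges route → lookup rest g ≡ false
      rest⊆F : ∀ g → lookup rest g ≡ true → lookup F g ≡ true
      excess-split : ∀ w → excess G F w ≡ excess G rest w + ∂ (s , t) w
  open Extraction

  extraction-refl : ∀ {F s} → Extraction F s s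
  extraction-refl {F} {s} = record
    { route = []
    ; rest = F
    ; route⊆F = λ _ ()
    ; route∉rest = λ _ ()
    ; rest⊆F = λ _ Fg → Fg
    ; excess-split = λ w → sym (+-∂-diag (excess G F w) s w)
    }

  extraction-step : ∀ {F s w t} g → lookup F g ≡ true → lookup G g ≡ (s , w) →
    Extraction (F [ g ]≔ false) w t → Extraction F s t
  extraction-step {F} {s} {w} {t} g Fg g=sw r = record
    { route = step g g=sw (route r)
    ; rest = rest r
    ; route⊆F = λ { _ (here refl) → Fg ; h (there i) → cleared-⊆ F g h (route⊆F r h i) }
    ; route∉rest = λ { _ (here refl) → g∉rest ; h (there i) → route∉rest r h i }
    ; rest⊆F = λ h Rh → cleared-⊆ F g h (rest⊆F r h Rh)
    ; excess-split = split
    }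
    where
    g∉rest : lookup (rest r) g ≡ false
    g∉rest = ¬-not λ Rg → contradiction (trans (sym (lookup-set F g false)) (rest⊆F r g Rg)) λ ()
    split : ∀ z → excess G F z ≡ excess G (rest r) z + ∂ (s , t) z
    split z = begin
      excess G F z                                        ≡⟨ excess-clear G F g z Fg ⟩
      ∂ (lookup G g) z + excess G (F [ g ]≔ false) z      ≡⟨ cong₂ (λ e x → ∂ e z + x) g=sw (excess-split r z) ⟩
      ∂ (s , w) z + (excess G (rest r) z + ∂ (w , t) z)   ≡⟨ x∙yz≈y∙xz (∂ (s , w) z) (excess G (rest r) z) (∂ (w , t) z) ⟩
      excess G (rest r) z + (∂ (s , w) z + ∂ (w , t) z)   ≡⟨ cong (excess G (rest r) z +_) (∂-concat s w t z) ⟩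
      excess G (rest r) z + ∂ (s , t) z                   ∎

  -- Follow edges of F out of s, deleting them; DrainsTo guarantees such an edge
  -- until t is reached, and size F bounds the number of steps.
  extract : ∀ k {F s t} → size F ℕ.< k → DrainsTo F s t → Extraction F s t
  extract (suc k) {F} {s} {t} |F|<k drains with s ≟ t
  ... | yes refl = extraction-refl
  ... | no s≢t with excess-positive⇒outEdge G F s (proj₁ drains s≢t)
  ...   | g , Fg , refl = extraction-step g Fg refl
          (extract k (subst (ℕ._≤ k) (size-clear F g Fg) (s≤s⁻¹ |F|<k)) (drainsTo-clear g Fg refl s≢t drains))

  extraction : ∀ {F s t} → DrainsTo F s t → Extraction F s t
  extraction {F} = extract (suc (size F)) ℕₚ.≤-refl

  twoEDP-of-value-two : ∀ {F a b} → a ≢ b → (∀ w → excess G F w ≡ ∂ (a , b) w + ∂ (a , b) w) →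
    TwoEDP G a b
  twoEDP-of-value-two {F} {a} {b} a≢b value-two = proj₁ path₁ , proj₁ path₂ , disjoint
    where
    ∂≤2∂ : ∀ {z} → z ≢ b → ∂ (a , b) z ≤ ∂ (a , b) z + ∂ (a , b) z
    ∂≤2∂ z≢b = ℤₚ.≤-trans (ℤₚ.≤-reflexive (sym (ℤₚ.+-identityʳ (∂ (a , b) _)))) (ℤₚ.+-monoʳ-≤ (∂ (a , b) _) (0≤∂ a z≢b))
    first : Extraction F a b
    first = extraction (drainsTo-if-∂≤excess a≢b λ z z≢b → subst (_ ≤_) (sym (value-two z)) (∂≤2∂ z≢b))
    value-one : ∀ w → excess G (rest first) w ≡ ∂ (a , b) w
    value-one w = ∙-cancelʳ (∂ (a , b) w) _ _ (trans (sym (excess-split first w)) (value-two w))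
    second : Extraction (rest first) a b
    second = extraction (drainsTo-if-∂≤excess a≢b λ z _ → ℤₚ.≤-reflexive (sym (value-one z)))
    path₁ : PathUsing a b (walkEdges (route first))
    path₁ = toPath (route first)
    path₂ : PathUsing a b (walkEdges (route second))
    path₂ = toPath (route second)
    disjoint : EdgeDisjoint (proj₁ path₁) (proj₁ path₂)
    disjoint g g∈₁ g∈₂ = contradiction
      (trans (sym (route∉rest first g (proj₂ path₁ g∈₁))) (route⊆F second g (proj₂ path₂ g∈₂))) λ ()

  freshAugmenting : ∀ {F a b} (p : Walk G a b) → Unique (walkEdges p) →
    (∀ g → g ∈ walkEdges p → lookup F g ≡ false) → Augmenting F a b
  freshAugmenting [] _ _ = []
  freshAugmenting {F} (step g eq p) (g∉p ∷ p!) unused = forward g (unused g (here refl)) eq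
    (freshAugmenting p p! λ h h∈p → trans (lookup-set-≢ F true (All.lookup g∉p h∈p)) (unused h (there h∈p)))

  augment-fresh-mono : ∀ {F a b} (p : Walk G a b) p! unused {h} → lookup F h ≡ true →
    lookup (augment (freshAugmenting {F} p p! unused)) h ≡ true
  augment-fresh-mono [] _ _ Fh = Fh
  augment-fresh-mono {F} (step g eq p) (_ ∷ p!) _ {h} Fh = augment-fresh-mono p p! _ set
    where
    set : lookup (F [ g ]≔ true) h ≡ true
    set with g ≟ h
    ... | yes refl = lookup-set F g true
    ... | no g≢h = trans (lookup-set-≢ F true g≢h) Fh

  augment-fresh-∈ : ∀ {F a b} (p : Walk G a b) p! unused {h} → h ∈ walkEdges p →
    lookup (augment (freshAugmenting {F} p p! unused)) h ≡ true
  augment-fresh-∈ {F} (step g eq p) (_ ∷ p!) _ (here refl) = augment-fresh-mono p p! _ (lookup-set F g true)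
  augment-fresh-∈ (step g eq p) (_ ∷ p!) _ (there h∈p) = augment-fresh-∈ p p! _ h∈p

  augment-fresh⁻ : ∀ {F a b} (p : Walk G a b) p! unused {h} →
    lookup (augment (freshAugmenting {F} p p! unused)) h ≡ true → lookup F h ≡ true ⊎ h ∈ walkEdges p
  augment-fresh⁻ [] _ _ Fh = inj₁ Fh
  augment-fresh⁻ {F} (step g eq p) (_ ∷ p!) _ {h} Ah with augment-fresh⁻ p p! _ Ah
  ... | inj₂ h∈p = inj₂ (there h∈p)
  ... | inj₁ F′h with g ≟ h
  ...   | yes refl = inj₂ (here refl)
  ...   | no g≢h = inj₁ (trans (sym (lookup-set-≢ F true g≢h)) F′h)

  orient : Bool → Fin n × Fin n → Fin n × Fin n
  orient b e = if b then swap e else e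

  residual : Flow m → Digraph n m
  residual F = tabulate λ g → orient (lookup F g) (lookup G g)

  lookup-residual : ∀ F g → lookup (residual F) g ≡ orient (lookup F g) (lookup G g)
  lookup-residual F g = Vecₚ.lookup∘tabulate _ g

  residualAugmenting : ∀ F₀ {F a b} (p : Walk (residual F₀) a b) → Unique (walkEdges p) →
    (∀ g → g ∈ walkEdges p → lookup F g ≡ lookup F₀ g) → Augmenting F a b
  residualAugmenting F₀ [] _ _ = []
  residualAugmenting F₀ {F} (step {u = a} {v = c} g eq p) (g∉p ∷ p!) agree = along (lookup F₀ g) refl
    where
    continue : ∀ x → Augmenting (F [ g ]≔ x) c _
    continue x = residualAugmenting F₀ p p! λ h h∈p →
      trans (lookup-set-≢ F x (All.lookup g∉p h∈p)) (agree h (there h∈p))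
    oriented : ∀ {x} → lookup F₀ g ≡ x → orient x (lookup G g) ≡ (a , c)
    oriented F₀g = subst (λ x → orient x (lookup G g) ≡ (a , c)) F₀g (trans (sym (lookup-residual F₀ g)) eq)
    along : ∀ x → lookup F₀ g ≡ x → Augmenting F a _
    along true F₀g = backward g (trans (agree g (here refl)) F₀g) (cong swap (oriented F₀g)) (continue false)
    along false F₀g = forward g (trans (agree g (here refl)) F₀g) (oriented F₀g) (continue true)

  module _ {a b} (P : Path G a b) where

    private
      P! : Unique (walkEdges (walk P))
      P! = walkEdges-unique (walk P) (simple P)

      unused : ∀ g → g ∈ walkEdges (walk P) → lookup ∅ g ≡ false
      unused g _ = Vecₚ.lookup-replicate g false

      alongP : Augmenting ∅ a b
      alongP = freshAugmenting (walk P) P! unused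

      F₁ : Flow m
      F₁ = augment alongP

    separatingEdge : ¬ Reachable (residual F₁) a b → ∃ λ f → ∀ (w : Walk G a b) → f ∈ walkEdges w
    separatingEdge a↛b = f , uses-f
      where
      open Exits G (Reachable (residual F₁) a) (reachable? (residual F₁) a)
      traverse : ∀ {g} x → lookup F₁ g ≡ x → Reachable (residual F₁) a (proj₁ (orient x (lookup G g))) →
        Reachable (residual F₁) a (proj₂ (orient x (lookup G g)))
      traverse {g} x F₁g a→ = a→ ++ʷ step g (trans (lookup-residual F₁ g) (cong (λ x → orient x (lookup G g)) F₁g)) []
      never : NeverEnters (walk P)
      never g g∈P = traverse true (augment-fresh-∈ (walk P) P! unused g∈P)
      exit : ∃ λ g → g ∈ walkEdges (walk P) × Leaves g
      exit = leavingEdge (walk P) [] a↛b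
      f : Fin m
      f = proj₁ exit
      uses-f : ∀ w → f ∈ walkEdges w
      uses-f w = classify (lookup F₁ g) refl
        where
        crossing : ∃ λ g → g ∈ walkEdges w × Leaves g
        crossing = leavingEdge w [] a↛b
        g : Fin m
        g = proj₁ crossing
        classify : ∀ x → lookup F₁ g ≡ x → f ∈ walkEdges w
        classify false F₁g = ⊥-elim (proj₂ (proj₂ (proj₂ crossing)) (traverse false F₁g (proj₁ (proj₂ (proj₂ crossing)))))
        classify true F₁g with augment-fresh⁻ (walk P) P! unused F₁g
        ... | inj₁ ∅g = contradiction (trans (sym (Vecₚ.lookup-replicate g false)) ∅g) λ ()
        ... | inj₂ g∈P = subst (_∈ walkEdges w)
          (leavingEdge-unique (walk P) never g∈P (proj₁ (proj₂ exit)) (proj₂ (proj₂ crossing)) (proj₂ (proj₂ exit)))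
          (proj₁ (proj₂ crossing))

    twoEDP-or-separatingEdge : a ≢ b → TwoEDP G a b ⊎ ∃ λ f → ∀ (w : Walk G a b) → f ∈ walkEdges w
    twoEDP-or-separatingEdge a≢b with reachable? (residual F₁) a b
    ... | no a↛b = inj₂ (separatingEdge a↛b)
    ... | yes a→b = inj₁ (twoEDP-of-value-two a≢b value-two)
      where
      R : Path (residual F₁) a b
      R = proj₁ (toPath a→b)
      alongR : Augmenting F₁ a b
      alongR = residualAugmenting F₁ (walk R) (walkEdges-unique (walk R) (simple R)) λ _ _ → refl
      value-two : ∀ w → excess G (augment alongR) w ≡ ∂ (a , b) w + ∂ (a , b) w
      value-two w = begin
        excess G (augment alongR) w                 ≡⟨ excess-augment alongR w ⟩
        excess G F₁ w + ∂ (a , b) w                 ≡⟨ cong (_+ ∂ (a , b) w) (excess-augment alongP w) ⟩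
        (excess G ∅ w + ∂ (a , b) w) + ∂ (a , b) w  ≡⟨ cong (λ x → (x + ∂ (a , b) w) + ∂ (a , b) w) (excess-∅ G w) ⟩
        (0ℤ + ∂ (a , b) w) + ∂ (a , b) w            ≡⟨ cong (_+ ∂ (a , b) w) (ℤₚ.+-identityˡ (∂ (a , b) w)) ⟩
        ∂ (a , b) w + ∂ (a , b) w                   ∎

menger₂ : ∀ {n m} {G : Digraph n m} {a b} → a ≢ b → Walk G a b →
  (∀ f → Σ (Walk G a b) λ w → f ∉ walkEdges w) → TwoEDP G a b
menger₂ {G = G} a≢b p avoid with twoEDP-or-separatingEdge G (proj₁ (toPath p)) a≢b
... | inj₁ two = two
... | inj₂ (f , cut) = let (w , f∉w) = avoid f in contradiction (cut w) f∉w

HasSCCCount-≤ : ∀ {n m m′} {G : Digraph n m} {H : Digraph n m′} {k k′} →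
  (∀ {u v} → MutuallyReachable G u v → MutuallyReachable H u v) →
  HasSCCCount G k → HasSCCCount H k′ → k′ ℕ.≤ k
HasSCCCount-≤ {k′ = k′} G⇒H (f , _ , f-classes) (f′ , f′-onto , f′-classes) = Finₚ.injective⇒≤ injective
  where
  rep : Fin k′ → Fin _
  rep i = proj₁ (f′-onto i)
  injective : ∀ {i j} → f (rep i) ≡ f (rep j) → i ≡ j
  injective {i} {j} same = trans (sym (proj₂ (f′-onto i) refl))
    (trans (Equivalence.from (f′-classes _ _) (G⇒H (Equivalence.to (f-classes _ _) same))) (proj₂ (f′-onto j) refl))

Pairwise2EC-map : ∀ {n m m′} {G : Digraph n m} {H : Digraph n m′} →
  (∀ {a b} → TwoEDP G a b → TwoEDP H a b) → ∀ B → Pairwise2EC G B → Pairwise2EC H B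
Pairwise2EC-map G⇒H B pairwise v w v∈B w∈B v≢w =
  let (_ , vw , wv) = pairwise v w v∈B w∈B v≢w in v≢w , G⇒H vw , G⇒H wv

Is2ECBlock-map : ∀ {n m m′} {G : Digraph n m} {H : Digraph n m′} →
  (∀ {a b} → TwoEDP G a b → TwoEDP H a b) → (∀ {a b} → TwoEDP H a b → TwoEDP G a b) →
  ∀ B → Is2ECBlock G B → Is2ECBlock H B
Is2ECBlock-map G⇒H H⇒G B (pairwise , maximal) =
  Pairwise2EC-map G⇒H B pairwise , λ B′ B⊆B′ pairwise′ → maximal B′ B⊆B′ (Pairwise2EC-map H⇒G B′ pairwise′)

same2ECBlocks : ∀ {n m m′} {G : Digraph n m} {H : Digraph n m′} →
  (∀ {a b} → TwoEDP G a b → TwoEDP H a b) → (∀ {a b} → TwoEDP H a b → TwoEDP G a b) → Same2ECBlocks G H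
same2ECBlocks G⇒H H⇒G B = mk⇔ (Is2ECBlock-map G⇒H H⇒G B) (Is2ECBlock-map H⇒G G⇒H B)

-- Deleting an edge

module _ {n m} (G : Digraph n (suc m)) (e : Fin (suc m)) where

  lookup-∖ : ∀ i → lookup (G ∖ e) i ≡ lookup G (punchIn e i)
  lookup-∖ i = trans (cong (lookup (G ∖ e)) (sym (Finₚ.punchOut-punchIn e)))
                     (Vecₚ.removeAt-punchOut G (λ e≡ → Finₚ.punchInᵢ≢i e i (sym e≡)))

  lift : ∀ {a b} → Walk (G ∖ e) a b → Walk G a b
  lift [] = []
  lift (step g eq p) = step (punchIn e g) (trans (sym (lookup-∖ g)) eq) (lift p)

  walkVerts-lift : ∀ {a b} (p : Walk (G ∖ e) a b) → walkVerts (lift p) ≡ walkVerts p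
  walkVerts-lift [] = refl
  walkVerts-lift {a} (step g eq p) = cong (a ∷_) (walkVerts-lift p)

  walkEdges-lift : ∀ {a b} (p : Walk (G ∖ e) a b) → walkEdges (lift p) ≡ map (punchIn e) (walkEdges p)
  walkEdges-lift [] = refl
  walkEdges-lift (step g eq p) = cong (punchIn e g ∷_) (walkEdges-lift p)

  liftPath : ∀ {a b} → Path (G ∖ e) a b → Path G a b
  liftPath P = path (lift (walk P)) (subst Unique (sym (walkVerts-lift (walk P))) (simple P))

  TwoEDP-lift : ∀ {a b} → TwoEDP (G ∖ e) a b → TwoEDP G a b
  TwoEDP-lift (P , Q , disjoint) = liftPath P , liftPath Q , disjoint′
    where
    disjoint′ : EdgeDisjoint (liftPath P) (liftPath Q)
    disjoint′ g g∈P g∈Q with ∈-map⁻ (punchIn e) (subst (g ∈_) (walkEdges-lift (walk P)) g∈P)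
                           | ∈-map⁻ (punchIn e) (subst (g ∈_) (walkEdges-lift (walk Q)) g∈Q)
    ... | h , h∈P , refl | h′ , h′∈Q , same =
      disjoint h h∈P (subst (_∈ walkEdges (walk Q)) (sym (Finₚ.punchIn-injective e h h′ same)) h′∈Q)

  module _ {x y} (e=xy : lookup G e ≡ (x , y)) where

    reroute : ∀ {a b} (p : Walk G a b) (q : Walk (G ∖ e) x y) →
      Σ (Walk (G ∖ e) a b) λ r → ∀ {h} → h ∈ walkEdges r → h ∈ walkEdges q ⊎ punchIn e h ∈ walkEdges p
    reroute [] q = [] , λ ()
    reroute (step g eq p) q with reroute p q | g ≟ e
    ... | r , r⊆ | yes refl with trans (sym eq) e=xy
    ...   | refl = q ++ʷ r , λ h∈ →
            [ inj₁ , (λ h∈r → map₂ there (r⊆ h∈r)) ]′ (∈-++⁻ (walkEdges q) (subst (_ ∈_) (walkEdges-++ʷ q r) h∈))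
    reroute (step g eq p) q | r , r⊆ | no g≢e =
      step (punchOut e≢g) (trans (Vecₚ.removeAt-punchOut G e≢g) eq) r ,
      λ { (here refl) → inj₂ (here (Finₚ.punchIn-punchOut e≢g)) ; (there h∈r) → map₂ there (r⊆ h∈r) }
      where
      e≢g : e ≢ g
      e≢g e≡g = g≢e (sym e≡g)

    ¬StrongBridge : Walk (G ∖ e) x y → ¬ StrongBridge G e
    ¬StrongBridge q (k , k′ , count , count′ , k<k′) = ℕₚ.<⇒≱ k<k′ (HasSCCCount-≤ unlift count count′)
      where
      unlift : ∀ {u v} → MutuallyReachable G u v → MutuallyReachable (G ∖ e) u v
      unlift (p , p′) = proj₁ (reroute p q) , proj₁ (reroute p′ q)

    TwoEDP-unlift : TwoEDP (G ∖ e) x y → ∀ {a b} → TwoEDP G a b → TwoEDP (G ∖ e) a b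
    TwoEDP-unlift bypass {a} {b} two with a ≟ b
    ... | yes refl = TwoEDP-refl a
    ... | no a≢b = menger₂ a≢b (proj₁ (reroute (walk (proj₁ two)) (walk (proj₁ bypass)))) avoid
      where
      avoid : ∀ f → Σ (Walk (G ∖ e) a b) λ w → f ∉ walkEdges w
      avoid f with avoidingWalk two (punchIn e f) | avoidingWalk bypass f
      ... | p , f∉p | q , f∉q = let (r , r⊆) = reroute p q in r , λ f∈r → [ f∉q , f∉p ]′ (r⊆ f∈r)

lemma1 : ∀ {n m} (G : Digraph n (suc m)) (e : Fin (suc m)) (x y : Fin n) →
    lookup G e ≡ (x , y) → StronglyConnected G →
    (TestA G e x y → TestB G e) ×
    (SameBlock G x y → TestB G e → TestA G e x y)
lemma1 G e x y e=xy _ = testA⇒testB , sameBlock⇒testB⇒testA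
  where
  testA⇒testB : TestA G e x y → TestB G e
  testA⇒testB bypass =
    ¬StrongBridge G e e=xy (walk (proj₁ bypass)) ,
    same2ECBlocks (TwoEDP-unlift G e e=xy bypass) (TwoEDP-lift G e)
  sameBlock⇒testB⇒testA : SameBlock G x y → TestB G e → TestA G e x y
  sameBlock⇒testB⇒testA (B , block , x∈B , y∈B) (_ , same) with x ≟ y
  ... | yes refl = TwoEDP-refl x
  ... | no x≢y = proj₁ (proj₂ (proj₁ (Equivalence.to (same B) block) x y x∈B y∈B x≢y))
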